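{- Let $G=(V,E)$ be a graph that has at least one split independent set. Then $\beta_s(G)\le \Gamma_s(G)$ and $\gamma_s(G)\le i_s(G)$.
   Context: All graphs are finite, undirected, simple, connected, with no isolated vertices. $N[v]$ is the closed neighborhood of $v$, $N[S]=\bigcup_{v\in S}N[v]$; $S$ is dominating if $N[S]=V$; $S$ is independent if $\langle S\rangle$ has no edges. A split dominating set is a dominating set $S$ such that the induced subgraph $\langle V\setminus S\rangle$ is disconnected or a $K_1$. A split dominating set $S$ is minimal if for every $v\in S$ at least one holds: (1) there is $w\in N[v]$ with $w\notin N[S\setminus\{v\}]$; (2) $\langle (V\setminus S)\cup\{v\}\rangle$ is connected. A split independent set is an independent set $S$ with $\langle V\setminus S\rangle$ disconnected or a $K_1$; it is maximal if for every $v\in V\setminus S$ at least one holds: (1) $S\cup\{v\}$ is not independent; (2) $\langle V\setminus(S\cup\{v\})\rangle$ is connected. Parameters: $\gamma_s(G)=\min\{|S|: S \text{ split dominating}\}$, $\Gamma_s(G)=\max\{|S|: S\text{ minimal split dominating}\}$, $i_s(G)=\min\{|S|: S\text{ maximal split independent}\}$, $\beta_s(G)=\max\{|S|: S\text{ maximal split independent}\}$. -}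

module Defs where

open import Data.Nat using (ℕ; _≤_)
open import Data.Bool using (Bool; true; false)
open import Data.Fin using (Fin)
open import Data.Fin.Subset using (Subset; _∈_; _∉_; ∁; _∪_; ⁅_⁆; _-_; ∣_∣; ⊤)
open import Data.Product using (Σ; ∃; _×_)
open import Data.Sum using (_⊎_)
open import Relation.Nullary using (¬_)
open import Relation.Binary.PropositionalEquality using (_≡_)

data Walk {n : ℕ} (adj : Fin n → Fin n → Bool) (W : Subset n) : Fin n → Fin n → Set where
  here : ∀ {u} → u ∈ W → Walk adj W u u
  step : ∀ {u w v} → u ∈ W → adj u w ≡ true → Walk adj W w v → Walk adj W u v

-- The induced subgraph ⟨W⟩ is connected (the empty graph counts as connected).
InducedConnected : {n : ℕ} → (Fin n → Fin n → Bool) → Subset n → Set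
InducedConnected adj W = ∀ u v → u ∈ W → v ∈ W → Walk adj W u v

record Graph (n : ℕ) : Set where
  field
    adj        : Fin n → Fin n → Bool
    adj-sym    : ∀ u v → adj u v ≡ adj v u
    adj-irrefl : ∀ v → adj v v ≡ false
    connected  : InducedConnected adj ⊤
    noIsolated : ∀ u → ∃ λ v → adj u v ≡ true

module _ {n : ℕ} (G : Graph n) where
  open Graph G

  Adj : Fin n → Fin n → Set
  Adj u v = adj u v ≡ true

  InClosedNbhd : Fin n → Fin n → Set
  InClosedNbhd v w = (w ≡ v) ⊎ Adj v w

  InNbhdSet : Subset n → Fin n → Set
  InNbhdSet S w = ∃ λ v → v ∈ S × InClosedNbhd v w

  Dominating : Subset n → Set
  Dominating S = ∀ w → InNbhdSet S w

  Independent : Subset n → Set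
  Independent S = ∀ u v → u ∈ S → v ∈ S → ¬ Adj u v

  DisconnectedOrK1 : Subset n → Set
  DisconnectedOrK1 W = (¬ InducedConnected adj W) ⊎ (∣ W ∣ ≡ 1)

  SplitDominating : Subset n → Set
  SplitDominating S = Dominating S × DisconnectedOrK1 (∁ S)

  MinimalSplitDominating : Subset n → Set
  MinimalSplitDominating S =
    SplitDominating S ×
    (∀ v → v ∈ S →
       (∃ λ w → InClosedNbhd v w × ¬ InNbhdSet (S - v) w)
       ⊎ InducedConnected adj (∁ S ∪ ⁅ v ⁆))

  SplitIndependent : Subset n → Set
  SplitIndependent S = Independent S × DisconnectedOrK1 (∁ S)

  MaximalSplitIndependent : Subset n → Set
  MaximalSplitIndependent S =
    SplitIndependent S ×
    (∀ v → v ∉ S →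
       (¬ Independent (S ∪ ⁅ v ⁆))
       ⊎ InducedConnected adj (∁ (S ∪ ⁅ v ⁆)))

IsMaxCard : {n : ℕ} → (Subset n → Set) → ℕ → Set
IsMaxCard {n} P k = (∃ λ S → P S × ∣ S ∣ ≡ k) × (∀ S → P S → ∣ S ∣ ≤ k)

IsMinCard : {n : ℕ} → (Subset n → Set) → ℕ → Set
IsMinCard {n} P k = (∃ λ S → P S × ∣ S ∣ ≡ k) × (∀ S → P S → k ≤ ∣ S ∣)

module _ {n : ℕ} (G : Graph n) where
  IsGammaS : ℕ → Set
  IsGammaS = IsMinCard (SplitDominating G)

  IsUpperGammaS : ℕ → Set
  IsUpperGammaS = IsMaxCard (MinimalSplitDominating G)

  IsIS : ℕ → Set
  IsIS = IsMinCard (MaximalSplitIndependent G)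

  IsBetaS : ℕ → Set
  IsBetaS = IsMaxCard (MaximalSplitIndependent G)

-- A maximal split independent set S is already a minimal split dominating set.
-- It dominates: an undominated vertex w could be added to S keeping it
-- independent, so by maximality ⟨V ∖ (S ∪ {w})⟩ would be connected; as w has a
-- neighbour outside S, ⟨V ∖ S⟩ would then be connected and have two vertices,
-- contradicting the split condition. It is minimal: by independence each v ∈ S
-- is its own private neighbour with respect to S ∖ {v}. Hence β_s ≤ Γ_s, and
-- γ_s ≤ i_s because a minimum maximal split independent set is split dominating.
module Submission where

open import Defs
open import Data.Nat using (ℕ; _≤_; _<_)
open import Data.Nat.Properties using (<-irrefl)
open import Data.Bool using (true)
open import Data.Bool.Properties using () renaming (_≟_ to _≟ᵇ_)
open import Data.Fin using (Fin; _≟_)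
open import Data.Fin.Properties using (any?)
open import Data.Fin.Subset
  using (Subset; _∈_; _∉_; _⊆_; _⊂_; ∁; _∪_; _─_; _-_; ⁅_⁆; ∣_∣; inside)
open import Data.Fin.Subset.Properties
  using ( _∈?_; x∈⁅x⁆; x∈⁅y⁆⇒x≡y; ∣⁅x⁆∣≡1; p⊂q⇒∣p∣<∣q∣; p⊆p∪q; x∈p∪q⁻
        ; p⊆q⇒∁p⊇∁q; x∉p⇒x∈∁p; x∈∁p⇒x∉p; p─q⊆p)
open import Data.Vec.Base using (_∷_; here; there)
open import Data.Product using (∃; _×_; _,_; proj₁; proj₂)
open import Data.Sum using (_⊎_; inj₁; inj₂; [_,_])
open import Data.Empty using (⊥-elim)
open import Relation.Nullary using (¬_; yes; no)
open import Relation.Nullary.Decidable using (_×-dec_; _⊎-dec_)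
open import Relation.Unary using (Decidable)
open import Relation.Binary.PropositionalEquality
  using (_≡_; _≢_; refl; sym; trans; subst)

x∈p─q⇒x∉q : ∀ {n} {x : Fin n} (p q : Subset n) → x ∈ p ─ q → x ∉ q
x∈p─q⇒x∉q (_ ∷ p) (inside ∷ q) () here
x∈p─q⇒x∉q (_ ∷ p) (_ ∷ q) (there x∈p─q) (there x∈q) = x∈p─q⇒x∉q p q x∈p─q x∈q

x∉p-x : ∀ {n} (p : Subset n) (x : Fin n) → x ∉ p - x
x∉p-x p x x∈p-x = x∈p─q⇒x∉q p ⁅ x ⁆ x∈p-x (x∈⁅x⁆ x)

x∈p∪⁅y⁆⇒x∈p⊎x≡y : ∀ {n} {x : Fin n} (p : Subset n) (y : Fin n) →
                  x ∈ p ∪ ⁅ y ⁆ → x ∈ p ⊎ x ≡ y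
x∈p∪⁅y⁆⇒x∈p⊎x≡y p y x∈p∪⁅y⁆ with x∈p∪q⁻ p ⁅ y ⁆ x∈p∪⁅y⁆
... | inj₁ x∈p = inj₁ x∈p
... | inj₂ x∈⁅y⁆ = inj₂ (x∈⁅y⁆⇒x≡y y x∈⁅y⁆)

x∈∁p∧x≢y⇒x∈∁[p∪⁅y⁆] : ∀ {n} {x y : Fin n} {p : Subset n} →
                      x ∈ ∁ p → x ≢ y → x ∈ ∁ (p ∪ ⁅ y ⁆)
x∈∁p∧x≢y⇒x∈∁[p∪⁅y⁆] {y = y} {p} x∈∁p x≢y =
  x∉p⇒x∈∁p (λ m → [ x∈∁p⇒x∉p x∈∁p , x≢y ] (x∈p∪⁅y⁆⇒x∈p⊎x≡y p y m))

x∈p∧y∈p∧x≢y⇒1<∣p∣ : ∀ {n} {x y : Fin n} {p : Subset n} →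
                    x ∈ p → y ∈ p → x ≢ y → 1 < ∣ p ∣
x∈p∧y∈p∧x≢y⇒1<∣p∣ {x = x} {y} x∈p y∈p x≢y =
  subst (_< _) (∣⁅x⁆∣≡1 x) (p⊂q⇒∣p∣<∣q∣ ⁅x⁆⊂p)
  where
  ⁅x⁆⊂p : ⁅ x ⁆ ⊂ _
  ⁅x⁆⊂p = (λ z∈⁅x⁆ → subst (_∈ _) (sym (x∈⁅y⁆⇒x≡y x z∈⁅x⁆)) x∈p)
        , y , y∈p , (λ y∈⁅x⁆ → x≢y (sym (x∈⁅y⁆⇒x≡y x y∈⁅x⁆)))

module _ {n : ℕ} (G : Graph n) where
  open Graph G

  Walk-mono : ∀ {W W′ u v} → W ⊆ W′ → Walk adj W u v → Walk adj W′ u v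
  Walk-mono W⊆W′ (here u∈W)        = here (W⊆W′ u∈W)
  Walk-mono W⊆W′ (step u∈W uw walk) = step (W⊆W′ u∈W) uw (Walk-mono W⊆W′ walk)

  Walk-snoc : ∀ {W u v w} → Walk adj W u v → Adj G v w → w ∈ W → Walk adj W u w
  Walk-snoc (here v∈W)         vw w∈W = step v∈W vw (here w∈W)
  Walk-snoc (step u∈W uu′ walk) vw w∈W = step u∈W uu′ (Walk-snoc walk vw w∈W)

  connected-extend : ∀ {W W′ w v} → W ⊆ W′ → w ∈ W′ →
                     (∀ {x} → x ∈ W′ → x ≢ w → x ∈ W) → v ∈ W → Adj G w v →
                     InducedConnected adj W → InducedConnected adj W′
  connected-extend {w = w} {v} W⊆W′ w∈W′ rest v∈W wv conn x y x∈W′ y∈W′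
    with x ≟ w | y ≟ w
  ... | yes refl | yes refl = here w∈W′
  ... | yes refl | no y≢w   = step w∈W′ wv (Walk-mono W⊆W′ (conn v y v∈W (rest y∈W′ y≢w)))
  ... | no x≢w   | yes refl =
    Walk-snoc (Walk-mono W⊆W′ (conn x v (rest x∈W′ x≢w) v∈W)) (trans (adj-sym v w) wv) w∈W′
  ... | no x≢w   | no y≢w   = Walk-mono W⊆W′ (conn x y (rest x∈W′ x≢w) (rest y∈W′ y≢w))

  InNbhdSet? : (S : Subset n) → Decidable (InNbhdSet G S)
  InNbhdSet? S w = any? (λ v → (v ∈? S) ×-dec ((w ≟ v) ⊎-dec (adj v w ≟ᵇ true)))

  undominated⇒∉ : ∀ {S w} → ¬ InNbhdSet G S w → w ∉ S
  undominated⇒∉ {w = w} ¬dom w∈S = ¬dom (w , w∈S , inj₁ refl)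

  undominated⇒independent-∪ : ∀ {S w} → Independent G S → ¬ InNbhdSet G S w →
                              Independent G (S ∪ ⁅ w ⁆)
  undominated⇒independent-∪ {S} {w} ind ¬dom x y x∈ y∈ xy
    with x∈p∪⁅y⁆⇒x∈p⊎x≡y S w x∈ | x∈p∪⁅y⁆⇒x∈p⊎x≡y S w y∈
  ... | inj₁ x∈S  | inj₁ y∈S  = ind x y x∈S y∈S xy
  ... | inj₁ x∈S  | inj₂ refl = ¬dom (x , x∈S , inj₂ xy)
  ... | inj₂ refl | inj₁ y∈S  = ¬dom (y , y∈S , inj₂ (trans (adj-sym y x) xy))
  ... | inj₂ refl | inj₂ refl with trans (sym xy) (adj-irrefl x)
  ... | ()

  undominated⇒neighbour∉ : ∀ {S w} → ¬ InNbhdSet G S w →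
                           ∃ λ v → Adj G w v × v ∉ S × v ≢ w
  undominated⇒neighbour∉ {w = w} ¬dom =
    v , wv , (λ v∈S → ¬dom (v , v∈S , inj₂ (trans (adj-sym v w) wv))) , v≢w
    where
    v : Fin n
    v = proj₁ (noIsolated w)
    wv : Adj G w v
    wv = proj₂ (noIsolated w)
    v≢w : v ≢ w
    v≢w v≡w with trans (sym (subst (Adj G w) v≡w wv)) (adj-irrefl w)
    ... | ()

  undominated⇒∁-connected : ∀ {S w} → ¬ InNbhdSet G S w →
                            InducedConnected adj (∁ (S ∪ ⁅ w ⁆)) →
                            InducedConnected adj (∁ S)
  undominated⇒∁-connected {w = w} ¬dom conn with undominated⇒neighbour∉ ¬dom
  ... | v , wv , v∉S , v≢w =
    connected-extend (p⊆q⇒∁p⊇∁q (p⊆p∪q ⁅ w ⁆)) (x∉p⇒x∈∁p (undominated⇒∉ ¬dom))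
      x∈∁p∧x≢y⇒x∈∁[p∪⁅y⁆] (x∈∁p∧x≢y⇒x∈∁[p∪⁅y⁆] (x∉p⇒x∈∁p v∉S) v≢w) wv conn

  undominated⇒1<∣∁S∣ : ∀ {S w} → ¬ InNbhdSet G S w → 1 < ∣ ∁ S ∣
  undominated⇒1<∣∁S∣ ¬dom with undominated⇒neighbour∉ ¬dom
  ... | v , _ , v∉S , v≢w =
    x∈p∧y∈p∧x≢y⇒1<∣p∣ (x∉p⇒x∈∁p v∉S) (x∉p⇒x∈∁p (undominated⇒∉ ¬dom)) v≢w

  maximalSplitIndependent⇒¬undominated : ∀ {S w} → MaximalSplitIndependent G S →
                                         ¬ ¬ InNbhdSet G S w
  maximalSplitIndependent⇒¬undominated {w = w} ((ind , split) , maximal) ¬dom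
    with maximal w (undominated⇒∉ ¬dom)
  ... | inj₁ ¬ind = ¬ind (undominated⇒independent-∪ ind ¬dom)
  ... | inj₂ conn =
    [ (λ ¬conn → ¬conn (undominated⇒∁-connected ¬dom conn))
    , (λ ∣∁S∣≡1 → <-irrefl (sym ∣∁S∣≡1) (undominated⇒1<∣∁S∣ ¬dom))
    ] split

  maximalSplitIndependent⇒dominating : ∀ {S} → MaximalSplitIndependent G S →
                                       Dominating G S
  maximalSplitIndependent⇒dominating {S} msi w with InNbhdSet? S w
  ... | yes dom  = dom
  ... | no ¬dom = ⊥-elim (maximalSplitIndependent⇒¬undominated msi ¬dom)

  independent⇒∉N[S-v] : ∀ {S v} → Independent G S → v ∈ S → ¬ InNbhdSet G (S - v) v
  independent⇒∉N[S-v] {S} {v} _ _ (u , u∈S-v , inj₁ refl) = x∉p-x S v u∈S-v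
  independent⇒∉N[S-v] {S} {v} ind v∈S (u , u∈S-v , inj₂ uv) =
    ind u v (p─q⊆p S ⁅ v ⁆ u∈S-v) v∈S uv

  maximalSplitIndependent⇒minimalSplitDominating :
    ∀ {S} → MaximalSplitIndependent G S → MinimalSplitDominating G S
  maximalSplitIndependent⇒minimalSplitDominating msi@((ind , split) , _) =
    (maximalSplitIndependent⇒dominating msi , split) ,
    λ v v∈S → inj₁ (v , inj₁ refl , independent⇒∉N[S-v] ind v∈S)

-- The existence hypothesis only ensures that β_s and i_s are defined; here
-- their values are given together with witnesses, so it is not needed.
mainTheorem3 : {n : ℕ} (G : Graph n) →
    (∃ λ (S : Subset n) → SplitIndependent G S) →
    (∀ b Γ → IsBetaS G b → IsUpperGammaS G Γ → b ≤ Γ) ×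
    (∀ g i → IsGammaS G g → IsIS G i → g ≤ i)
mainTheorem3 G _ = β≤Γ , γ≤i
  where
  β≤Γ : ∀ b Γ → IsBetaS G b → IsUpperGammaS G Γ → b ≤ Γ
  β≤Γ _ _ ((S , msi , refl) , _) (_ , Γ-max) =
    Γ-max S (maximalSplitIndependent⇒minimalSplitDominating G msi)
  γ≤i : ∀ g i → IsGammaS G g → IsIS G i → g ≤ i
  γ≤i _ _ (_ , γ-min) ((S , msi , refl) , _) =
    γ-min S (proj₁ (maximalSplitIndependent⇒minimalSplitDominating G msi))
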